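{- Let $(\chi,\phi)$ be a feasible solution of the linear system below, and run the naive randomized rounding. Then for every $w\in\{v\}\cup I^+_v$, every child $u$ of $w$ (so $u\in I^+_v\cup\Lambda^+_v$), and every $\ell'\in L$, $$\Pr[\ell_u=\ell']=\sum_{t\in\Gamma^-(u,\ell')}\phi_{w,t}.$$
   Context: Let $T$ be a perfect binary tree, $L$ a finite label set and $\Gamma\subseteq L\times L\times L$ a set of triples $(\ell_{\rm P},\ell_{\rm L},\ell_{\rm R})$ (parent, left child, right child labels). Fix a vertex $v$, a label $\ell\in L$ and an integer $h\ge1$ such that $v$ has descendants $h$ levels below. Let $\Lambda^+_v$ be the descendants of $v$ exactly $h$ levels below $v$, and $I^+_v$ the descendants of $v$ strictly between $v$ and $\Lambda^+_v$. For $\ell'\in L$ let $\Gamma^+(\ell')$ be the triples in $\Gamma$ with first coordinate $\ell'$; for $u\in I^+_v\cup\Lambda^+_v$ let $\Gamma^-(u,\ell')$ be the triples with second coordinate $\ell'$ if $u$ is a left child, and with third coordinate $\ell'$ if $u$ is a right child. The system has variables $\phi_{u,t}\ge0$ for $u\in\{v\}\cup I^+_v$, $t\in\Gamma$, and $\chi_{u,\ell'}$ for $u\in\Lambda^+_v$, $\ell'\in L$, with constraints: $\sum_{t\in\Gamma^+(\ell)}\phi_{v,t}=1$; $\phi_{v,t}=0$ for $t\notin\Gamma^+(\ell)$; $\sum_{t\in\Gamma^+(\ell')}\phi_{u,t}=\sum_{t\in\Gamma^-(u,\ell')}\phi_{w,t}$ for all $u\in I^+_v$ with parent $w$ and all $\ell'\in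 L$; and $\chi_{u,\ell'}=\sum_{t\in\Gamma^-(u,\ell')}\phi_{w,t}$ for all $u\in\Lambda^+_v$ with parent $w$ and all $\ell'\in L$. Naive randomized rounding: set $\ell_v=\ell$; proceeding top-down, for each $u\in\{v\}\cup I^+_v$ whose label $\ell_u$ has been fixed, choose (independently) a triple $t\in\Gamma^+(\ell_u)$ with probability $\phi_{u,t}/\sum_{t'\in\Gamma^+(\ell_u)}\phi_{u,t'}$ and give the left and right children of $u$ the second and third coordinates of $t$ as labels.
   Formalization: The feasible solution $(\chi,\phi)$ of the linear system takes values in the rationals. -}

module Defs where

open import Data.Bool using (Bool; true; false; if_then_else_)
open import Data.Nat using (ℕ; zero; suc)
open import Data.Fin using (Fin; _≟_)
open import Data.List using (List; []; _∷_; _∷ʳ_; concatMap; filter; map; foldr; allFin)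
open import Data.Product using (_×_; _,_; proj₁; proj₂)
open import Data.Rational using (ℚ; 0ℚ; 1ℚ; _+_; _*_; _÷_; ≢-nonZero)
open import Data.Rational.Properties using () renaming (_≟_ to _≟ℚ_)
open import Relation.Nullary using (yes; no; does)
open import Relation.Binary.PropositionalEquality using (_≡_)

Triple : ℕ → Set
Triple k = Fin k × Fin k × Fin k

par lft rgt : ∀ {k} → Triple k → Fin k
par t = proj₁ t
lft t = proj₁ (proj₂ t)
rgt t = proj₂ (proj₂ t)

childLabel : ∀ {k} → Bool → Triple k → Fin k
childLabel false t = lft t
childLabel true  t = rgt t

allTriples : (k : ℕ) → List (Triple k)
allTriples k = concatMap (λ a → concatMap (λ b → map (λ c → (a , b , c)) (allFin k)) (allFin k)) (allFin k)

-- Γ ⊆ L × L × L, given by its (Boolean) membership predicate; listed without repetition.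
Γlist : ∀ {k} → (Triple k → Bool) → List (Triple k)
Γlist {k} Γ = filter (λ t → Γ t Data.Bool.≟ true) (allTriples k)

sumℚ : List ℚ → ℚ
sumℚ = foldr _+_ 0ℚ

ΣΓ : ∀ {k} → (Triple k → Bool) → (Triple k → Bool) → (Triple k → ℚ) → ℚ
ΣΓ Γ P f = sumℚ (map (λ t → if P t then f t else 0ℚ) (Γlist Γ))

isLabel : ∀ {k} → Fin k → Fin k → Bool
isLabel a b = does (a ≟ b)

ΣΓ⁺ : ∀ {k} → (Triple k → Bool) → Fin k → (Triple k → ℚ) → ℚ
ΣΓ⁺ Γ a f = ΣΓ Γ (λ t → isLabel (par t) a) f

-- Σ_{t ∈ Γ⁻(u, a)} f t, where u is the child of its parent in direction b
ΣΓ⁻ : ∀ {k} → (Triple k → Bool) → Bool → Fin k → (Triple k → ℚ) → ℚ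
ΣΓ⁻ Γ b a f = ΣΓ Γ (λ t → isLabel (childLabel b t) a) f

-- x / y, with the (irrelevant) convention x / 0 = 0
_÷₀_ : ℚ → ℚ → ℚ
x ÷₀ y with y ≟ℚ 0ℚ
... | yes _ = 0ℚ
... | no y≢0 = _÷_ x y {{≢-nonZero y≢0}}

-- Vertices of the subtree of depth h below v are paths from v: lists of
-- directions (false = left, true = right), first element = first step from v.
Path : Set
Path = List Bool

-- An elementary outcome of the rounding: a triple chosen at every internal
-- vertex (a vertex at depth < d of the subtree of depth d).
data Choices {k : ℕ} : ℕ → Set where
  leaf : Choices zero
  node : ∀ {d} → Triple k → Choices {k} d → Choices {k} d → Choices (suc d)

allChoices : ∀ {k} → (Triple k → Bool) → (d : ℕ) → List (Choices {k} d)
allChoices Γ zero = leaf ∷ []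
allChoices Γ (suc d) =
  concatMap (λ t → concatMap (λ l → map (λ r → node t l r) (allChoices Γ d)) (allChoices Γ d)) (Γlist Γ)

module Rounding {k : ℕ} (Γ : Triple k → Bool) (φ : Path → Triple k → ℚ) where

  step : Path → Fin k → Triple k → ℚ
  step p a t = if isLabel (par t) a then φ p t ÷₀ ΣΓ⁺ Γ a (φ p) else 0ℚ

  -- probability of an outcome of the subtree rooted at p, whose label is a
  -- (independent choices: product over internal vertices)
  weight : ∀ {d} → Path → Fin k → Choices {k} d → ℚ
  weight p a leaf = 1ℚ
  weight p a (node t l r) =
    step p a t * (weight (p ∷ʳ false) (lft t) l * weight (p ∷ʳ true) (rgt t) r)

  labelAt : ∀ {d} → Fin k → Choices {k} d → Path → Fin k
  labelAt a c [] = a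
  labelAt a leaf (_ ∷ _) = a
  labelAt a (node t l r) (false ∷ q) = labelAt (lft t) l q
  labelAt a (node t l r) (true ∷ q) = labelAt (rgt t) r q

  -- Pr[ℓ_u = ℓ'] for the naive rounding started with ℓ_v = ℓ on the subtree of depth h
  Pr : (h : ℕ) (ℓ : Fin k) (u : Path) (ℓ' : Fin k) → ℚ
  Pr h ℓ u ℓ' =
    sumℚ (map (λ c → if isLabel (labelAt ℓ c u) ℓ' then weight [] ℓ c else 0ℚ) (allChoices Γ h))

-- Let μ_p(a) = Σ_{t ∈ Γ⁺(a)} φ_{p,t} be the LP mass of label a at vertex p.  The rounding
-- chooses t at p with probability φ_{p,t} / μ_p(par t), so if the label of p is distributed
-- according to μ_p, the triple chosen at p is distributed according to φ_p, and hence the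
-- label of the child of p in direction b is distributed according to Σ_{t ∈ Γ⁻(b,·)} φ_{p,t},
-- which by the consistency constraints is μ of that child.  At the root μ is the point mass
-- at ℓ, so induction down the path to u gives the claim.  Along the way one checks that the
-- rounding weights of every subtree sum to 1 whenever its root has positive mass; where the
-- mass is 0, nonnegativity forces the φ-values feeding into it to vanish as well.
module Submission where

open import Defs
open import Data.Bool using (Bool; true; false; if_then_else_; not)
open import Data.Nat using (ℕ; suc; _<_; _≥_)
open import Data.Fin using (Fin)
open import Data.List using (List; []; length; _∷ʳ_)
open import Data.Rational using (ℚ; 0ℚ; 1ℚ; _≤_)
open import Relation.Binary.PropositionalEquality using (_≡_; _≢_)

open import Algebra.Bundles using (CommutativeMonoid)
import Data.Bool as Bool
open import Data.Nat using (zero; _+_; z<s; s≤s)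
open import Data.Nat.Properties using (+-suc; m<m+n; <-trans; n<1+n)
open import Data.Fin using (_≟_)
import Data.Fin as Fin
open import Data.List using (_∷_; _++_; map; concatMap; allFin; tabulate)
open import Data.List.Properties using (map-tabulate; ++-assoc; ++-identityʳ)
open import Data.List.Membership.Propositional using (_∈_)
open import Data.List.Membership.Propositional.Properties using (∈-filter⁻)
open import Data.List.Relation.Unary.Any using (here; there)
open import Data.Product using (_×_; _,_; proj₂)
open import Data.Rational using (_*_; 1/_; ≢-nonZero) renaming (_+_ to _+ℚ_)
open import Data.Rational.Properties
  using (+-identityˡ; +-identityʳ; +-assoc; *-identityˡ; *-identityʳ; *-zeroˡ; *-zeroʳ; *-assoc; *-comm;
         *-distribˡ-+; *-distribʳ-+; *-inverseˡ; ≤-refl; ≤-antisym; +-mono-≤; +-monoʳ-≤;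
         +-0-commutativeMonoid)
  renaming (_≟_ to _≟ℚ_)
open import Algebra.Properties.CommutativeSemigroup
  (CommutativeMonoid.commutativeSemigroup +-0-commutativeMonoid) using (interchange)
open import Relation.Nullary using (yes; no)
open import Relation.Nullary.Decidable using (dec-true)
open import Relation.Binary.PropositionalEquality using (refl; sym; trans; cong; cong₂; subst)
open Relation.Binary.PropositionalEquality.≡-Reasoning

private
  variable
    A B : Set

∑ : List A → (A → ℚ) → ℚ
∑ xs f = sumℚ (map f xs)

∑-cong-∈ : (xs : List A) {f g : A → ℚ} → (∀ x → x ∈ xs → f x ≡ g x) → ∑ xs f ≡ ∑ xs g
∑-cong-∈ []       f≗g = refl
∑-cong-∈ (x ∷ xs) f≗g =
  cong₂ _+ℚ_ (f≗g x (here refl)) (∑-cong-∈ xs (λ y y∈xs → f≗g y (there y∈xs)))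

∑-cong : (xs : List A) {f g : A → ℚ} → (∀ x → f x ≡ g x) → ∑ xs f ≡ ∑ xs g
∑-cong xs f≗g = ∑-cong-∈ xs (λ x _ → f≗g x)

∑-0 : (xs : List A) → ∑ xs (λ _ → 0ℚ) ≡ 0ℚ
∑-0 []       = refl
∑-0 (x ∷ xs) = trans (cong (0ℚ +ℚ_) (∑-0 xs)) (+-identityˡ 0ℚ)

∑-+ : (xs : List A) (f g : A → ℚ) → ∑ xs (λ x → f x +ℚ g x) ≡ ∑ xs f +ℚ ∑ xs g
∑-+ []       f g = sym (+-identityˡ 0ℚ)
∑-+ (x ∷ xs) f g =
  trans (cong (f x +ℚ g x +ℚ_) (∑-+ xs f g)) (interchange (f x) (g x) (∑ xs f) (∑ xs g))

∑-*ˡ : (xs : List A) (c : ℚ) (f : A → ℚ) → ∑ xs (λ x → c * f x) ≡ c * ∑ xs f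
∑-*ˡ []       c f = sym (*-zeroʳ c)
∑-*ˡ (x ∷ xs) c f = trans (cong (c * f x +ℚ_) (∑-*ˡ xs c f)) (sym (*-distribˡ-+ c (f x) (∑ xs f)))

∑-*ʳ : (xs : List A) (c : ℚ) (f : A → ℚ) → ∑ xs (λ x → f x * c) ≡ ∑ xs f * c
∑-*ʳ []       c f = sym (*-zeroˡ c)
∑-*ʳ (x ∷ xs) c f = trans (cong (f x * c +ℚ_) (∑-*ʳ xs c f)) (sym (*-distribʳ-+ c (f x) (∑ xs f)))

∑-swap : (xs : List A) (ys : List B) (g : A → B → ℚ) →
         ∑ xs (λ x → ∑ ys (g x)) ≡ ∑ ys (λ y → ∑ xs (λ x → g x y))
∑-swap []       ys g = sym (∑-0 ys)
∑-swap (x ∷ xs) ys g =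
  trans (cong (∑ ys (g x) +ℚ_) (∑-swap xs ys g)) (sym (∑-+ ys (g x) (λ y → ∑ xs (λ x′ → g x′ y))))

∑-++ : (xs ys : List A) (f : A → ℚ) → ∑ (xs ++ ys) f ≡ ∑ xs f +ℚ ∑ ys f
∑-++ []       ys f = sym (+-identityˡ _)
∑-++ (x ∷ xs) ys f = trans (cong (f x +ℚ_) (∑-++ xs ys f)) (sym (+-assoc (f x) _ _))

∑-concatMap : (xs : List A) (g : A → List B) (f : B → ℚ) →
              ∑ (concatMap g xs) f ≡ ∑ xs (λ x → ∑ (g x) f)
∑-concatMap []       g f = refl
∑-concatMap (x ∷ xs) g f =
  trans (∑-++ (g x) (concatMap g xs) f) (cong (∑ (g x) f +ℚ_) (∑-concatMap xs g f))

∑-map : (xs : List A) (g : A → B) (f : B → ℚ) → ∑ (map g xs) f ≡ ∑ xs (λ x → f (g x))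
∑-map []       g f = refl
∑-map (x ∷ xs) g f = cong (f (g x) +ℚ_) (∑-map xs g f)

∑-if : (xs : List A) (c : Bool) (f : A → ℚ) →
       ∑ xs (λ x → if c then f x else 0ℚ) ≡ (if c then ∑ xs f else 0ℚ)
∑-if xs true  f = refl
∑-if xs false f = ∑-0 xs

∑-nonNeg : (xs : List A) (f : A → ℚ) → (∀ x → x ∈ xs → 0ℚ ≤ f x) → 0ℚ ≤ ∑ xs f
∑-nonNeg []       f f≥0 = ≤-refl
∑-nonNeg (x ∷ xs) f f≥0 = subst (_≤ f x +ℚ ∑ xs f) (+-identityˡ 0ℚ)
  (+-mono-≤ (f≥0 x (here refl)) (∑-nonNeg xs f (λ y y∈xs → f≥0 y (there y∈xs))))

nonNeg+nonNeg≡0 : ∀ p q → 0ℚ ≤ p → 0ℚ ≤ q → p +ℚ q ≡ 0ℚ → p ≡ 0ℚ × q ≡ 0ℚ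
nonNeg+nonNeg≡0 p q p≥0 q≥0 p+q≡0 =
  ≤-antisym (subst (p ≤_) p+q≡0 p≤p+q) p≥0 , ≤-antisym (subst (q ≤_) p+q≡0 q≤p+q) q≥0
  where
  p≤p+q : p ≤ p +ℚ q
  p≤p+q = subst (_≤ p +ℚ q) (+-identityʳ p) (+-monoʳ-≤ p q≥0)
  q≤p+q : q ≤ p +ℚ q
  q≤p+q = subst (_≤ p +ℚ q) (+-identityˡ q) (+-mono-≤ p≥0 (≤-refl {q}))

∑-nonNeg-≡0 : (xs : List A) (f : A → ℚ) → (∀ x → x ∈ xs → 0ℚ ≤ f x) → ∑ xs f ≡ 0ℚ →
              ∀ x → x ∈ xs → f x ≡ 0ℚ
∑-nonNeg-≡0 (y ∷ xs) f f≥0 ∑≡0 x x∈ with nonNeg+nonNeg≡0 (f y) (∑ xs f) (f≥0 y (here refl))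
                                              (∑-nonNeg xs f (λ z z∈xs → f≥0 z (there z∈xs))) ∑≡0
∑-nonNeg-≡0 (y ∷ xs) f f≥0 ∑≡0 x (here refl) | fy≡0 , _   = fy≡0
∑-nonNeg-≡0 (y ∷ xs) f f≥0 ∑≡0 x (there x∈) | _ , ∑xs≡0 =
  ∑-nonNeg-≡0 xs f (λ z z∈xs → f≥0 z (there z∈xs)) ∑xs≡0 x x∈

isLabel-refl : ∀ {k} (x : Fin k) → isLabel x x ≡ true
isLabel-refl x = dec-true (x ≟ x) refl

sum-tabulate-select : ∀ n (x : Fin n) (g : Fin n → ℚ) →
                      sumℚ (tabulate (λ a → if isLabel x a then g a else 0ℚ)) ≡ g x
sum-tabulate-select (suc n) Fin.zero    g =
  trans (cong (g Fin.zero +ℚ_) sum-tabulate-0) (+-identityʳ _)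
  where
  sum-tabulate-0 : sumℚ (tabulate {n = n} (λ _ → 0ℚ)) ≡ 0ℚ
  sum-tabulate-0 = trans (cong sumℚ (sym (map-tabulate {n = n} (λ a → a) (λ _ → 0ℚ)))) (∑-0 (allFin n))
sum-tabulate-select (suc n) (Fin.suc x) g = trans (+-identityˡ _) (sum-tabulate-select n x (λ a → g (Fin.suc a)))

∑-allFin-select : ∀ {k} (x : Fin k) (g : Fin k → ℚ) →
                  ∑ (allFin k) (λ a → if isLabel x a then g a else 0ℚ) ≡ g x
∑-allFin-select {k} x g =
  trans (cong sumℚ (map-tabulate (λ a → a) (λ a → if isLabel x a then g a else 0ℚ)))
        (sum-tabulate-select k x g)

∑-point-mass : ∀ {k} (x : Fin k) (μ g : Fin k → ℚ) → (∀ a → μ a ≡ (if isLabel x a then 1ℚ else 0ℚ)) →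
               ∑ (allFin k) (λ a → μ a * g a) ≡ g x
∑-point-mass {k} x μ g μ≡δ = trans (∑-cong (allFin k) μg≡δg) (∑-allFin-select x g)
  where
  μg≡δg : ∀ a → μ a * g a ≡ (if isLabel x a then g a else 0ℚ)
  μg≡δg a rewrite μ≡δ a with isLabel x a
  ... | true  = *-identityˡ (g a)
  ... | false = *-zeroˡ (g a)

if-*ˡ : ∀ (c : Bool) x y → (if c then x * y else 0ℚ) ≡ (if c then x else 0ℚ) * y
if-*ˡ true  x y = refl
if-*ˡ false x y = sym (*-zeroˡ y)

if-*ʳ : ∀ (c : Bool) x y → (if c then x * y else 0ℚ) ≡ x * (if c then y else 0ℚ)
if-*ʳ true  x y = refl
if-*ʳ false x y = sym (*-zeroʳ x)

p*[q÷₀p]≡q : ∀ p q → (p ≡ 0ℚ → q ≡ 0ℚ) → p * (q ÷₀ p) ≡ q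
p*[q÷₀p]≡q p q p≡0⇒q≡0 with p ≟ℚ 0ℚ
... | yes p≡0 = trans (*-zeroʳ p) (sym (p≡0⇒q≡0 p≡0))
... | no p≢0 = begin
  p * (q * 1/ p)   ≡⟨ *-comm p _ ⟩
  q * 1/ p * p     ≡⟨ *-assoc q _ p ⟩
  q * (1/ p * p)   ≡⟨ cong (q *_) (*-inverseˡ p) ⟩
  q * 1ℚ           ≡⟨ *-identityʳ q ⟩
  q                ∎
  where instance _ = ≢-nonZero p≢0

p*q≡p⇒q≡1 : ∀ p q → p ≢ 0ℚ → p * q ≡ p → q ≡ 1ℚ
p*q≡p⇒q≡1 p q p≢0 pq≡p = begin
  q                ≡⟨ sym (*-identityˡ q) ⟩
  1ℚ * q           ≡⟨ cong (_* q) (sym (*-inverseˡ p)) ⟩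
  1/ p * p * q     ≡⟨ *-assoc (1/ p) p q ⟩
  1/ p * (p * q)   ≡⟨ cong (1/ p *_) pq≡p ⟩
  1/ p * p         ≡⟨ *-inverseˡ p ⟩
  1ℚ               ∎
  where instance _ = ≢-nonZero p≢0

length-∷ʳ : ∀ (p : List A) x → length (p ∷ʳ x) ≡ suc (length p)
length-∷ʳ []      x = refl
length-∷ʳ (_ ∷ p) x = cong suc (length-∷ʳ p x)

depth-∷ʳ : ∀ (p : List A) x {d h} → length p + suc d ≡ h → length (p ∷ʳ x) + d ≡ h
depth-∷ʳ p x {d} e = trans (cong (_+ d) (length-∷ʳ p x)) (trans (sym (+-suc (length p) d)) e)

m+1+n≡h⇒m<h : ∀ m {n h} → m + suc n ≡ h → m < h
m+1+n≡h⇒m<h m e = subst (m <_) e (m<m+n m z<s)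

suc-length<h : ∀ (p : List A) {d h} → length p + suc (suc d) ≡ h → suc (length p) < h
suc-length<h p {d} e = m+1+n≡h⇒m<h (suc (length p)) (trans (sym (+-suc (length p) (suc d))) e)

∑-ΣΓ⁻-* : ∀ {k} (Γ : Triple k → Bool) b (f : Triple k → ℚ) (G : Fin k → ℚ) →
          ∑ (allFin k) (λ a → ΣΓ⁻ Γ b a f * G a) ≡ ∑ (Γlist Γ) (λ t → f t * G (childLabel b t))
∑-ΣΓ⁻-* {k} Γ b f G = begin
  ∑ (allFin k) (λ a → ΣΓ⁻ Γ b a f * G a)
    ≡⟨ ∑-cong (allFin k) (λ a → trans (sym (∑-*ʳ (Γlist Γ) (G a) _))
         (∑-cong (Γlist Γ) (λ t → sym (if-*ˡ (isLabel (childLabel b t) a) (f t) (G a))))) ⟩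
  ∑ (allFin k) (λ a → ∑ (Γlist Γ) (λ t → if isLabel (childLabel b t) a then f t * G a else 0ℚ))
    ≡⟨ ∑-swap (allFin k) (Γlist Γ) _ ⟩
  ∑ (Γlist Γ) (λ t → ∑ (allFin k) (λ a → if isLabel (childLabel b t) a then f t * G a else 0ℚ))
    ≡⟨ ∑-cong (Γlist Γ) (λ t → ∑-allFin-select (childLabel b t) (λ a → f t * G a)) ⟩
  ∑ (Γlist Γ) (λ t → f t * G (childLabel b t)) ∎

module LabelDistribution
  {k : ℕ} (Γ : Triple k → Bool) (h : ℕ) (φ : Path → Triple k → ℚ)
  (φ-nonNeg : ∀ u t → length u < h → Γ t ≡ true → 0ℚ ≤ φ u t)
  (φ-consistent : ∀ w b ℓ′ → suc (length w) < h → ΣΓ⁺ Γ ℓ′ (φ (w ∷ʳ b)) ≡ ΣΓ⁻ Γ b ℓ′ (φ w))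
  where

  open Rounding Γ φ

  Γl : List (Triple k)
  Γl = Γlist Γ

  ∈Γl⇒Γ : ∀ {t} → t ∈ Γl → Γ t ≡ true
  ∈Γl⇒Γ t∈ = proj₂ (∈-filter⁻ (λ t → Γ t Bool.≟ true) {xs = allTriples k} t∈)

  mass : Path → Fin k → ℚ
  mass p a = ΣΓ⁺ Γ a (φ p)

  total : Path → Fin k → ℕ → ℚ
  total p a d = ∑ (allChoices Γ d) (weight p a)

  marginal : Path → Fin k → ℕ → Path → Fin k → ℚ
  marginal p a d q ℓ′ = ∑ (allChoices Γ d) (λ c → if isLabel (labelAt a c q) ℓ′ then weight p a c else 0ℚ)

  ∑-allChoices-suc : ∀ d (F : Choices (suc d) → ℚ) (s : Triple k → ℚ) (f g : Triple k → Choices d → ℚ) →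
    (∀ t l r → F (node t l r) ≡ s t * (f t l * g t r)) →
    ∑ (allChoices Γ (suc d)) F ≡ ∑ Γl (λ t → s t * (∑ (allChoices Γ d) (f t) * ∑ (allChoices Γ d) (g t)))
  ∑-allChoices-suc d F s f g F≡ = begin
    ∑ (allChoices Γ (suc d)) F
      ≡⟨ ∑-concatMap Γl _ F ⟩
    ∑ Γl (λ t → ∑ (concatMap (λ l → map (node t l) Ω) Ω) F)
      ≡⟨ ∑-cong Γl (λ t → trans (∑-concatMap Ω _ F) (∑-cong Ω (λ l → ∑-map Ω (node t l) F))) ⟩
    ∑ Γl (λ t → ∑ Ω (λ l → ∑ Ω (λ r → F (node t l r))))
      ≡⟨ ∑-cong Γl (λ t → ∑-cong Ω (λ l → ∑-cong Ω (F≡ t l))) ⟩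
    ∑ Γl (λ t → ∑ Ω (λ l → ∑ Ω (λ r → s t * (f t l * g t r))))
      ≡⟨ ∑-cong Γl (λ t → ∑-cong Ω (λ l → trans (∑-*ˡ Ω (s t) _) (cong (s t *_) (∑-*ˡ Ω (f t l) (g t))))) ⟩
    ∑ Γl (λ t → ∑ Ω (λ l → s t * (f t l * ∑ Ω (g t))))
      ≡⟨ ∑-cong Γl (λ t → trans (∑-*ˡ Ω (s t) _) (cong (s t *_) (∑-*ʳ Ω (∑ Ω (g t)) (f t)))) ⟩
    ∑ Γl (λ t → s t * (∑ Ω (f t) * ∑ Ω (g t))) ∎
    where Ω = allChoices Γ d

  total-zero : ∀ p a → total p a zero ≡ 1ℚ
  total-zero p a = +-identityʳ 1ℚ

  total-suc : ∀ p a d → total p a (suc d) ≡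
    ∑ Γl (λ t → step p a t * (total (p ∷ʳ false) (lft t) d * total (p ∷ʳ true) (rgt t) d))
  total-suc p a d = ∑-allChoices-suc d (weight p a) (step p a)
    (λ t → weight (p ∷ʳ false) (lft t)) (λ t → weight (p ∷ʳ true) (rgt t)) (λ t l r → refl)

  marginal-[] : ∀ p a d ℓ′ → marginal p a d [] ℓ′ ≡ (if isLabel a ℓ′ then total p a d else 0ℚ)
  marginal-[] p a d ℓ′ = ∑-if (allChoices Γ d) (isLabel a ℓ′) (weight p a)

  marginal-suc : ∀ b p a d q ℓ′ → marginal p a (suc d) (b ∷ q) ℓ′ ≡
    ∑ Γl (λ t → step p a t *
                 (marginal (p ∷ʳ b) (childLabel b t) d q ℓ′ * total (p ∷ʳ not b) (childLabel (not b) t) d))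
  marginal-suc false p a d q ℓ′ = ∑-allChoices-suc d _ (step p a) hitˡ (λ t → weight (p ∷ʳ true) (rgt t))
    (λ t l r → trans (if-*ʳ (isLabel (labelAt (lft t) l q) ℓ′) (step p a t) _)
                     (cong (step p a t *_) (if-*ˡ (isLabel (labelAt (lft t) l q) ℓ′) _ _)))
    where
    hitˡ : Triple k → Choices d → ℚ
    hitˡ t l = if isLabel (labelAt (lft t) l q) ℓ′ then weight (p ∷ʳ false) (lft t) l else 0ℚ
  marginal-suc true p a d q ℓ′ =
    trans (∑-allChoices-suc d _ (step p a) wˡ hitʳ
            (λ t l r → trans (if-*ʳ (isLabel (labelAt (rgt t) r q) ℓ′) (step p a t) _)
                             (cong (step p a t *_) (if-*ʳ (isLabel (labelAt (rgt t) r q) ℓ′) (wˡ t l) _))))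
          (∑-cong Γl (λ t → cong (step p a t *_) (*-comm (∑ Ω (wˡ t)) (∑ Ω (hitʳ t)))))
    where
    Ω = allChoices Γ d
    wˡ hitʳ : Triple k → Choices d → ℚ
    wˡ t = weight (p ∷ʳ false) (lft t)
    hitʳ t r = if isLabel (labelAt (rgt t) r q) ℓ′ then weight (p ∷ʳ true) (rgt t) r else 0ℚ

  ΣΓ≡0⇒φ≡0 : ∀ p (P : Triple k → Bool) {t} → length p < h → t ∈ Γl → P t ≡ true →
             ΣΓ Γ P (φ p) ≡ 0ℚ → φ p t ≡ 0ℚ
  ΣΓ≡0⇒φ≡0 p P {t} p<h t∈ Pt ΣΓ≡0 =
    subst (λ c → (if c then φ p t else 0ℚ) ≡ 0ℚ) Pt (∑-nonNeg-≡0 Γl _ terms-nonNeg ΣΓ≡0 t t∈)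
    where
    terms-nonNeg : ∀ t′ → t′ ∈ Γl → 0ℚ ≤ (if P t′ then φ p t′ else 0ℚ)
    terms-nonNeg t′ t′∈ with P t′
    ... | true  = φ-nonNeg p t′ p<h (∈Γl⇒Γ t′∈)
    ... | false = ≤-refl

  mass-*-step : ∀ p a {t} (X : ℚ) → length p < h → t ∈ Γl →
    mass p a * (step p a t * X) ≡ (if isLabel (par t) a then φ p t * X else 0ℚ)
  mass-*-step p a {t} X p<h t∈ with par t ≟ a
  ... | yes t∈Γ⁺a = trans (sym (*-assoc (mass p a) _ X)) (cong (_* X) (p*[q÷₀p]≡q (mass p a) (φ p t)
          (ΣΓ≡0⇒φ≡0 p (λ t′ → isLabel (par t′) a) p<h t∈ (dec-true (par t ≟ a) t∈Γ⁺a))))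
  ... | no _ = trans (cong (mass p a *_) (*-zeroˡ X)) (*-zeroʳ (mass p a))

  mass-*-∑-step : ∀ p a (X : Triple k → ℚ) → length p < h →
    mass p a * ∑ Γl (λ t → step p a t * X t) ≡ ∑ Γl (λ t → if isLabel (par t) a then φ p t * X t else 0ℚ)
  mass-*-∑-step p a X p<h =
    trans (sym (∑-*ˡ Γl (mass p a) (λ t → step p a t * X t)))
          (∑-cong-∈ Γl (λ t t∈ → mass-*-step p a (X t) p<h t∈))

  ∑-mass-*-∑-step : ∀ p (X : Triple k → ℚ) → length p < h →
    ∑ (allFin k) (λ a → mass p a * ∑ Γl (λ t → step p a t * X t)) ≡ ∑ Γl (λ t → φ p t * X t)
  ∑-mass-*-∑-step p X p<h = begin
    ∑ (allFin k) (λ a → mass p a * ∑ Γl (λ t → step p a t * X t))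
      ≡⟨ ∑-cong (allFin k) (λ a → mass-*-∑-step p a X p<h) ⟩
    ∑ (allFin k) (λ a → ∑ Γl (λ t → if isLabel (par t) a then φ p t * X t else 0ℚ))
      ≡⟨ ∑-swap (allFin k) Γl (λ a t → if isLabel (par t) a then φ p t * X t else 0ℚ) ⟩
    ∑ Γl (λ t → ∑ (allFin k) (λ a → if isLabel (par t) a then φ p t * X t else 0ℚ))
      ≡⟨ ∑-cong Γl (λ t → ∑-allFin-select (par t) (λ _ → φ p t * X t)) ⟩
    ∑ Γl (λ t → φ p t * X t) ∎

  φ-absorbs : ∀ p b {t} (X : ℚ) → suc (length p) < h → t ∈ Γl →
    mass (p ∷ʳ b) (childLabel b t) * X ≡ mass (p ∷ʳ b) (childLabel b t) → φ p t * X ≡ φ p t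
  φ-absorbs p b {t} X p∷ʳb<h t∈ mX≡m with mass (p ∷ʳ b) (childLabel b t) ≟ℚ 0ℚ
  ... | yes m≡0 = trans (cong (_* X) φ≡0) (trans (*-zeroˡ X) (sym φ≡0))
    where
    φ≡0 : φ p t ≡ 0ℚ
    φ≡0 = ΣΓ≡0⇒φ≡0 p (λ t′ → isLabel (childLabel b t′) (childLabel b t)) (<-trans (n<1+n _) p∷ʳb<h) t∈
            (isLabel-refl (childLabel b t)) (trans (sym (φ-consistent p b _ p∷ʳb<h)) m≡0)
  ... | no m≢0 = trans (cong (φ p t *_) (p*q≡p⇒q≡1 _ X m≢0 mX≡m)) (*-identityʳ _)

  mutual
    mass-*-total : ∀ d p a → length p + d ≡ h → mass p a * total p a d ≡ mass p a
    mass-*-total zero    p a _ = trans (cong (mass p a *_) (total-zero p a)) (*-identityʳ _)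
    mass-*-total (suc d) p a e = begin
      mass p a * total p a (suc d)
        ≡⟨ cong (mass p a *_) (total-suc p a d) ⟩
      mass p a * ∑ Γl (λ t → step p a t * (Tˡ t * Tʳ t))
        ≡⟨ mass-*-∑-step p a (λ t → Tˡ t * Tʳ t) (m+1+n≡h⇒m<h _ e) ⟩
      ∑ Γl (λ t → if isLabel (par t) a then φ p t * (Tˡ t * Tʳ t) else 0ℚ)
        ≡⟨ ∑-cong-∈ Γl (λ t t∈ → cong (λ x → if isLabel (par t) a then x else 0ℚ) (φ-*-totals t∈)) ⟩
      mass p a ∎
      where
      Tˡ Tʳ : Triple k → ℚ
      Tˡ t = total (p ∷ʳ false) (lft t) d
      Tʳ t = total (p ∷ʳ true) (rgt t) d
      φ-*-totals : ∀ {t} → t ∈ Γl → φ p t * (Tˡ t * Tʳ t) ≡ φ p t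
      φ-*-totals {t} t∈ = begin
        φ p t * (Tˡ t * Tʳ t)  ≡⟨ sym (*-assoc (φ p t) _ _) ⟩
        φ p t * Tˡ t * Tʳ t    ≡⟨ cong (_* Tʳ t) (φ-*-total-child d p false e t∈) ⟩
        φ p t * Tʳ t           ≡⟨ φ-*-total-child d p true e t∈ ⟩
        φ p t                  ∎

    φ-*-total-child : ∀ d p b {t} → length p + suc d ≡ h → t ∈ Γl →
      φ p t * total (p ∷ʳ b) (childLabel b t) d ≡ φ p t
    φ-*-total-child zero    p b {t} _ _ =
      trans (cong (φ p t *_) (total-zero (p ∷ʳ b) (childLabel b t))) (*-identityʳ _)
    φ-*-total-child (suc d) p b     e t∈ =
      φ-absorbs p b _ (suc-length<h p e) t∈
        (mass-*-total (suc d) (p ∷ʳ b) _ (depth-∷ʳ p b e))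

  ∑-mass-*-marginal-suc : ∀ d p b q ℓ′ → length p + suc d ≡ h →
    ∑ (allFin k) (λ a → mass p a * marginal p a (suc d) (b ∷ q) ℓ′) ≡
    ∑ Γl (λ t → φ p t * marginal (p ∷ʳ b) (childLabel b t) d q ℓ′)
  ∑-mass-*-marginal-suc d p b q ℓ′ e = begin
    ∑ (allFin k) (λ a → mass p a * marginal p a (suc d) (b ∷ q) ℓ′)
      ≡⟨ ∑-cong (allFin k) (λ a → cong (mass p a *_) (marginal-suc b p a d q ℓ′)) ⟩
    ∑ (allFin k) (λ a → mass p a * ∑ Γl (λ t → step p a t * (Q t * T t)))
      ≡⟨ ∑-mass-*-∑-step p (λ t → Q t * T t) (m+1+n≡h⇒m<h _ e) ⟩
    ∑ Γl (λ t → φ p t * (Q t * T t))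
      ≡⟨ ∑-cong-∈ Γl φ-*-sibling-total ⟩
    ∑ Γl (λ t → φ p t * Q t) ∎
    where
    Q T : Triple k → ℚ
    Q t = marginal (p ∷ʳ b) (childLabel b t) d q ℓ′
    T t = total (p ∷ʳ not b) (childLabel (not b) t) d
    φ-*-sibling-total : ∀ t → t ∈ Γl → φ p t * (Q t * T t) ≡ φ p t * Q t
    φ-*-sibling-total t t∈ = begin
      φ p t * (Q t * T t) ≡⟨ cong (φ p t *_) (*-comm (Q t) (T t)) ⟩
      φ p t * (T t * Q t) ≡⟨ sym (*-assoc (φ p t) (T t) (Q t)) ⟩
      φ p t * T t * Q t   ≡⟨ cong (_* Q t) (φ-*-total-child d p (not b) e t∈) ⟩
      φ p t * Q t         ∎

  label-distribution : ∀ w d p b ℓ′ → length p + d ≡ h → length w < d →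
    ∑ (allFin k) (λ a → mass p a * marginal p a d (w ∷ʳ b) ℓ′) ≡ ΣΓ⁻ Γ b ℓ′ (φ (p ++ w))
  label-distribution [] (suc d) p b ℓ′ e _ = begin
    ∑ (allFin k) (λ a → mass p a * marginal p a (suc d) (b ∷ []) ℓ′)
      ≡⟨ ∑-mass-*-marginal-suc d p b [] ℓ′ e ⟩
    ∑ Γl (λ t → φ p t * marginal (p ∷ʳ b) (childLabel b t) d [] ℓ′)
      ≡⟨ ∑-cong-∈ Γl φ-*-marginal-[] ⟩
    ΣΓ⁻ Γ b ℓ′ (φ p)
      ≡⟨ cong (λ u → ΣΓ⁻ Γ b ℓ′ (φ u)) (sym (++-identityʳ p)) ⟩
    ΣΓ⁻ Γ b ℓ′ (φ (p ++ [])) ∎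
    where
    φ-*-marginal-[] : ∀ t → t ∈ Γl → φ p t * marginal (p ∷ʳ b) (childLabel b t) d [] ℓ′ ≡
                      (if isLabel (childLabel b t) ℓ′ then φ p t else 0ℚ)
    φ-*-marginal-[] t t∈ rewrite marginal-[] (p ∷ʳ b) (childLabel b t) d ℓ′ with isLabel (childLabel b t) ℓ′
    ... | true  = φ-*-total-child d p b e t∈
    ... | false = *-zeroʳ (φ p t)
  label-distribution (_ ∷ w) (suc zero) p b ℓ′ e (s≤s ())
  label-distribution (b₀ ∷ w) (suc (suc d)) p b ℓ′ e (s≤s w<d) = begin
    ∑ (allFin k) (λ a → mass p a * marginal p a (suc (suc d)) (b₀ ∷ (w ∷ʳ b)) ℓ′)
      ≡⟨ ∑-mass-*-marginal-suc (suc d) p b₀ (w ∷ʳ b) ℓ′ e ⟩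
    ∑ Γl (λ t → φ p t * G (childLabel b₀ t))
      ≡⟨ sym (∑-ΣΓ⁻-* Γ b₀ (φ p) G) ⟩
    ∑ (allFin k) (λ a → ΣΓ⁻ Γ b₀ a (φ p) * G a)
      ≡⟨ ∑-cong (allFin k) (λ a → cong (_* G a) (sym (φ-consistent p b₀ a (suc-length<h p e)))) ⟩
    ∑ (allFin k) (λ a → mass (p ∷ʳ b₀) a * G a)
      ≡⟨ label-distribution w (suc d) (p ∷ʳ b₀) b ℓ′ (depth-∷ʳ p b₀ e) w<d ⟩
    ΣΓ⁻ Γ b ℓ′ (φ ((p ∷ʳ b₀) ++ w))
      ≡⟨ cong (λ u → ΣΓ⁻ Γ b ℓ′ (φ u)) (++-assoc p (b₀ ∷ []) w) ⟩
    ΣΓ⁻ Γ b ℓ′ (φ (p ++ (b₀ ∷ w))) ∎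
    where
    G : Fin k → ℚ
    G a = marginal (p ∷ʳ b₀) a (suc d) (w ∷ʳ b) ℓ′

  mass-[]-point : ∀ ℓ → mass [] ℓ ≡ 1ℚ → (∀ t → Γ t ≡ true → par t ≢ ℓ → φ [] t ≡ 0ℚ) →
    ∀ a → mass [] a ≡ (if isLabel ℓ a then 1ℚ else 0ℚ)
  mass-[]-point ℓ mass≡1 φ≡0 a with ℓ ≟ a
  ... | yes refl = mass≡1
  ... | no ℓ≢a  = trans (∑-cong-∈ Γl term≡0) (∑-0 Γl)
    where
    term≡0 : ∀ t → t ∈ Γl → (if isLabel (par t) a then φ [] t else 0ℚ) ≡ 0ℚ
    term≡0 t t∈ with par t ≟ a
    ... | yes t∈Γ⁺a = φ≡0 t (∈Γl⇒Γ t∈) (λ t∈Γ⁺ℓ → ℓ≢a (trans (sym t∈Γ⁺ℓ) t∈Γ⁺a))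
    ... | no _      = refl

-- χ merely names the leaf marginals.
lemma4 : (k : ℕ) (Γ : Triple k → Bool) (ℓ : Fin k) (h : ℕ) → h ≥ 1 →
    (φ : Path → Triple k → ℚ) (χ : Path → Fin k → ℚ) →
    (∀ u t → length u < h → Γ t ≡ true → 0ℚ ≤ φ u t) →
    ΣΓ⁺ Γ ℓ (φ []) ≡ 1ℚ →
    (∀ t → Γ t ≡ true → par t ≢ ℓ → φ [] t ≡ 0ℚ) →
    (∀ w b ℓ' → suc (length w) < h →
      ΣΓ⁺ Γ ℓ' (φ (w ∷ʳ b)) ≡ ΣΓ⁻ Γ b ℓ' (φ w)) →
    (∀ w b ℓ' → suc (length w) ≡ h →
      χ (w ∷ʳ b) ℓ' ≡ ΣΓ⁻ Γ b ℓ' (φ w)) →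
    ∀ w b ℓ' → length w < h →
      Rounding.Pr Γ φ h ℓ (w ∷ʳ b) ℓ' ≡ ΣΓ⁻ Γ b ℓ' (φ w)
lemma4 k Γ ℓ h _ φ _ φ-nonNeg mass≡1 φ≡0 φ-consistent _ w b ℓ′ w<h = begin
  Rounding.Pr Γ φ h ℓ (w ∷ʳ b) ℓ′
    ≡⟨ sym (∑-point-mass ℓ (mass []) G (mass-[]-point ℓ mass≡1 φ≡0)) ⟩
  ∑ (allFin k) (λ a → mass [] a * G a)
    ≡⟨ label-distribution w h [] b ℓ′ refl w<h ⟩
  ΣΓ⁻ Γ b ℓ′ (φ w) ∎
  where
  open LabelDistribution Γ h φ φ-nonNeg φ-consistent
  G : Fin k → ℚ
  G a = marginal [] a h (w ∷ʳ b) ℓ′
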